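{- If $T$ is a tree, then $T\in\mathfrak{T}$ and $w_\tau(T)\leq\Delta(T)+2$, where $\Delta(T)$ is the maximum degree of $T$.
   Context: All graphs are finite, undirected, without loops or multiple edges. A total coloring of a graph $G$ is an assignment of colors to the vertices and edges of $G$ such that no two adjacent vertices, no two adjacent edges, and no vertex and an edge incident to it receive the same color. For a positive integer $t$, an interval total $t$-coloring of $G$ is a total coloring of $G$ with colors $1,2,\ldots,t$ such that each color $i\in\{1,\ldots,t\}$ is used on at least one vertex or edge, and for each vertex $v$ the set consisting of the color of $v$ and the colors of the edges incident to $v$ consists of $d_G(v)+1$ consecutive integers, where $d_G(v)$ is the degree of $v$. $\mathfrak{T}$ is the set of graphs having an interval total $t$-coloring for some $t\geq1$, and for $G\in\mathfrak{T}$, $w_\tau(G)$ is the least such $t$. -}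

module Defs where

open import Data.Nat using (ℕ; zero; suc; _+_; _≤_; _⊔_)
open import Data.Fin using (Fin)
open import Data.Bool using (Bool; true; false; T; if_then_else_)
open import Data.List using (List; []; _∷_; _++_; [_]; length; map; foldr)
open import Data.Nat.ListAction using (sum)
open import Data.List.Relation.Unary.Linked using (Linked)
open import Data.List.Relation.Unary.Unique.Propositional using (Unique)
open import Data.Product using (Σ; ∃; _×_; _,_)
open import Data.Sum using (_⊎_)
open import Data.Empty using (⊥)
open import Relation.Nullary using (¬_)
open import Relation.Binary.PropositionalEquality using (_≡_)
open import Function.Bundles using (_⇔_)
open import Data.List using () renaming (allFin to allFinL)

record Graph (n : ℕ) : Set where
  field
    adj    : Fin n → Fin n → Bool
    sym    : ∀ u v → adj u v ≡ adj v u
    irrefl : ∀ v → adj v v ≡ false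

open Graph public

Adj : ∀ {n} → Graph n → Fin n → Fin n → Set
Adj G u v = T (adj G u v)

deg : ∀ {n} → Graph n → Fin n → ℕ
deg {n} G v = sum (map (λ u → if adj G v u then 1 else 0) (allFinL n))

Δ : ∀ {n} → Graph n → ℕ
Δ {n} G = foldr _⊔_ 0 (map (deg G) (allFinL n))

data Walk {n : ℕ} (G : Graph n) : Fin n → Fin n → Set where
  here  : ∀ {v} → Walk G v v
  step  : ∀ {u w v} → Adj G u w → Walk G w v → Walk G u v

Connected : ∀ {n} → Graph n → Set
Connected G = ∀ u v → Walk G u v

IsCycle : ∀ {n} → Graph n → List (Fin n) → Set
IsCycle G [] = ⊥
IsCycle G (x ∷ xs) =
  3 ≤ length (x ∷ xs) × Unique (x ∷ xs) × Linked (Adj G) (x ∷ xs ++ [ x ])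

Acyclic : ∀ {n} → Graph n → Set
Acyclic G = ∀ xs → ¬ IsCycle G xs

IsTree : ∀ {n} → Graph n → Set
IsTree {n} G = 1 ≤ n × Connected G × Acyclic G

AtVertex : ∀ {n} → Graph n → (Fin n → ℕ) → (Fin n → Fin n → ℕ) → Fin n → ℕ → Set
AtVertex G vc ec v c = vc v ≡ c ⊎ Σ _ (λ u → Adj G v u × ec v u ≡ c)

record IntervalTotalColoring {n : ℕ} (G : Graph n) (t : ℕ) : Set where
  field
    vc : Fin n → ℕ
    ec : Fin n → Fin n → ℕ
    ec-sym      : ∀ u v → Adj G u v → ec u v ≡ ec v u
    vc-range    : ∀ v → 1 ≤ vc v × vc v ≤ t
    ec-range    : ∀ u v → Adj G u v → 1 ≤ ec u v × ec u v ≤ t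
    vv-proper   : ∀ u v → Adj G u v → ¬ vc u ≡ vc v
    ee-proper   : ∀ u v w → Adj G u v → Adj G u w → ¬ v ≡ w → ¬ ec u v ≡ ec u w
    ve-proper   : ∀ u v → Adj G u v → ¬ vc u ≡ ec u v
    all-used    : ∀ i → 1 ≤ i → i ≤ t →
                  (Σ _ (λ v → vc v ≡ i)) ⊎ Σ _ (λ u → Σ _ (λ v → Adj G u v × ec u v ≡ i))
    interval    : ∀ v → Σ ℕ (λ a → ∀ c → AtVertex G vc ec v c ⇔ (a ≤ c × c ≤ a + deg G v))

InT : ∀ {n} → Graph n → Set
InT G = Σ ℕ (λ t → 1 ≤ t × IntervalTotalColoring G t)

-- Grow the tree from a root one leaf at a time, keeping an interval total colouring of
-- the part built so far with at most Δ + 2 colours.  When a leaf w is attached to p, whose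
-- colours form the interval [a, a + d], the edge pw gets colour a − 1 or a + d + 1 and w a
-- colour next to it, so that p and w both see intervals again.  Going below works when
-- a ≥ 2 unless w would get the colour of p; going above needs at most d + 3 ≤ Δ + 2
-- colours, because p has d coloured neighbours besides w.  Acyclicity makes p the only
-- coloured neighbour of w, so no other vertex is affected.

module Submission where

open import Defs hiding (sym)
open import Data.Bool using (Bool; true; false; T; not; _∧_; if_then_else_)
open import Data.Bool.Properties using (T-≡; T-∧; ∧-zeroʳ; ∧-identityʳ; not-injective)
open import Data.Empty using (⊥-elim)
open import Data.Fin using (Fin; zero; suc; _≟_)
import Data.Fin.Properties as Finₚ
open import Data.List using (List; _∷_; _++_; [_]; length; foldr; tabulate)
open import Data.List.Membership.Propositional using () renaming (_∈_ to _∈ᴸ_)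
open import Data.List.Membership.Propositional.Properties using (∈-allFin; ∈-map⁺)
open import Data.List.Properties using (map-tabulate)
open import Data.List.Relation.Binary.Disjoint.Propositional using (Disjoint)
open import Data.List.Relation.Unary.All as All using (All; []; _∷_)
open import Data.List.Relation.Unary.All.Properties using (∷ʳ⁺)
open import Data.List.Relation.Unary.AllPairs using ([]; _∷_)
open import Data.List.Relation.Unary.Any using (here; there)
open import Data.List.Relation.Unary.Linked using (Linked; [-]; _∷_)
open import Data.List.Relation.Unary.Unique.Propositional using (Unique)
import Data.List.Relation.Unary.Unique.Propositional.Properties as Unique
open import Data.Nat using (ℕ; zero; suc; _+_; _≤_; _<_; _⊔_; z≤n; s≤s)
open import Data.Nat.ListAction using () renaming (sum to sumᴸ)
open import Data.Nat.Properties hiding (_≟_)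
open import Data.Nat.Properties using () renaming (_≟_ to _≟ℕ_)
open import Algebra.Properties.Monoid.Sum +-0-monoid using (sum; sum-cong-≗; sum-replicate-zero)
open import Data.Product using (Σ; ∃; ∃₂; _×_; _,_; proj₁; proj₂)
import Data.Product as Product
open import Data.Sum using (_⊎_; inj₁; inj₂; swap)
import Data.Sum as Sum
open import Data.Sum.Function.Propositional using (_⊎-⇔_)
open import Data.Vec.Functional using (updateAt)
open import Data.Vec.Functional.Properties using (updateAt-updates; updateAt-minimal)
open import Function using (_∘_; const; id)
open import Function.Bundles using (_⇔_; mk⇔; Equivalence)
import Function.Properties.Equivalence as ⇔
open import Relation.Nullary using (¬_; yes; no; contradiction)
open import Relation.Binary.PropositionalEquality hiding ([_])
open ≡-Reasoning

open Equivalence using (to; from)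

-- Intervals of colours

consecutive⇔interval : ∀ x c → (x ≡ c ⊎ suc x ≡ c) ⇔ (x ≤ c × c ≤ x + 1)
consecutive⇔interval x c rewrite +-comm x 1 = mk⇔ into onto
  where
  into : x ≡ c ⊎ suc x ≡ c → x ≤ c × c ≤ suc x
  into (inj₁ refl) = ≤-refl , n≤1+n x
  into (inj₂ refl) = n≤1+n x , ≤-refl
  onto : x ≤ c × c ≤ suc x → x ≡ c ⊎ suc x ≡ c
  onto (x≤c , c≤1+x) with m≤n⇒m<n∨m≡n x≤c
  ... | inj₁ x<c = inj₂ (≤-antisym x<c c≤1+x)
  ... | inj₂ x≡c = inj₁ x≡c

interval-extendˡ : ∀ a d c → ((suc a ≤ c × c ≤ suc a + d) ⊎ a ≡ c) ⇔ (a ≤ c × c ≤ a + suc d)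
interval-extendˡ a d c rewrite +-suc a d = mk⇔ into onto
  where
  into : (suc a ≤ c × c ≤ suc (a + d)) ⊎ a ≡ c → a ≤ c × c ≤ suc (a + d)
  into (inj₁ (a<c , c≤)) = <⇒≤ a<c , c≤
  into (inj₂ refl) = ≤-refl , m≤n⇒m≤1+n (m≤m+n a d)
  onto : a ≤ c × c ≤ suc (a + d) → (suc a ≤ c × c ≤ suc (a + d)) ⊎ a ≡ c
  onto (a≤c , c≤) with m≤n⇒m<n∨m≡n a≤c
  ... | inj₁ a<c = inj₁ (a<c , c≤)
  ... | inj₂ a≡c = inj₂ a≡c

interval-extendʳ : ∀ a d c → ((a ≤ c × c ≤ a + d) ⊎ suc (a + d) ≡ c) ⇔ (a ≤ c × c ≤ a + suc d)
interval-extendʳ a d c rewrite +-suc a d = mk⇔ into onto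
  where
  into : (a ≤ c × c ≤ a + d) ⊎ suc (a + d) ≡ c → a ≤ c × c ≤ suc (a + d)
  into (inj₁ (a≤c , c≤)) = a≤c , m≤n⇒m≤1+n c≤
  into (inj₂ refl) = m≤n⇒m≤1+n (m≤m+n a d) , ≤-refl
  onto : a ≤ c × c ≤ suc (a + d) → (a ≤ c × c ≤ a + d) ⊎ suc (a + d) ≡ c
  onto (a≤c , c≤) with m≤n⇒m<n∨m≡n c≤
  ... | inj₁ c<  = inj₁ (a≤c , ≤-pred c<)
  ... | inj₂ c≡ = inj₂ (sym c≡)

m<n∧n≤m⊔o⇒n≤o : ∀ {m n} o → m < n → n ≤ m ⊔ o → n ≤ o
m<n∧n≤m⊔o⇒n≤o {m} o m<n n≤m⊔o with ≤-total m o
... | inj₁ m≤o = subst (_ ≤_) (m≤n⇒m⊔n≡n m≤o) n≤m⊔o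
... | inj₂ o≤m = contradiction (subst (_ ≤_) (m≥n⇒m⊔n≡m o≤m) n≤m⊔o) (<⇒≱ m<n)

-- Colours for a new leaf

-- For a leaf w attached to p: the colours at p form the interval [a, a + d], p has
-- colour vp, and t colours are in use before and t′ after.
record LeafColours (a d vp t : ℕ) : Set where
  field
    edge leaf parent-lo leaf-lo t′ : ℕ
    edge∉parent     : ¬ (a ≤ edge × edge ≤ a + d)
    parent-interval : ∀ c → ((a ≤ c × c ≤ a + d) ⊎ edge ≡ c) ⇔ (parent-lo ≤ c × c ≤ parent-lo + suc d)
    leaf-interval   : ∀ c → (leaf ≡ c ⊎ edge ≡ c) ⇔ (leaf-lo ≤ c × c ≤ leaf-lo + 1)
    leaf≢edge       : leaf ≢ edge
    leaf≢parent     : leaf ≢ vp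
    edge-range      : 1 ≤ edge × edge ≤ t′
    leaf-range      : 1 ≤ leaf × leaf ≤ t′
    t≤t′            : t ≤ t′
    fresh           : ∀ i → t < i → i ≤ t′ → i ≡ edge ⊎ i ≡ leaf

edge-below-leaf-below : ∀ {k d vp t} → 3 + k + d ≤ t → 3 + k ≤ vp → LeafColours (3 + k) d vp t
edge-below-leaf-below {k} {d} {vp} {t} a+d≤t a≤vp = record
  { edge = 2 + k ; leaf = 1 + k ; parent-lo = 2 + k ; leaf-lo = 1 + k ; t′ = t
  ; edge∉parent     = λ (a≤edge , _) → 1+n≰n a≤edge
  ; parent-interval = interval-extendˡ (2 + k) d
  ; leaf-interval   = consecutive⇔interval (1 + k)
  ; leaf≢edge       = 1+n≢n ∘ sym
  ; leaf≢parent     = λ leaf≡vp → 1+n≰n (m+n≤o⇒n≤o 1 (subst (3 + k ≤_) (sym leaf≡vp) a≤vp))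
  ; edge-range      = s≤s z≤n , ≤-trans (n≤1+n _) a≤t
  ; leaf-range      = s≤s z≤n , ≤-trans (≤-trans (n≤1+n _) (n≤1+n _)) a≤t
  ; t≤t′            = ≤-refl
  ; fresh           = λ i t<i i≤t → contradiction i≤t (<⇒≱ t<i)
  }
  where
  a≤t : 3 + k ≤ t
  a≤t = m+n≤o⇒m≤o (3 + k) a+d≤t

edge-below-leaf-above : ∀ {k d vp t} → 1 ≤ k → suc k + d ≤ t → vp ≢ suc k → LeafColours (suc k) d vp t
edge-below-leaf-above {k} {d} {vp} {t} 1≤k a+d≤t vp≢a = record
  { edge = k ; leaf = suc k ; parent-lo = k ; leaf-lo = k ; t′ = t
  ; edge∉parent     = λ (a≤edge , _) → 1+n≰n a≤edge
  ; parent-interval = interval-extendˡ k d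
  ; leaf-interval   = λ c → ⇔.trans (mk⇔ swap swap) (consecutive⇔interval k c)
  ; leaf≢edge       = 1+n≢n
  ; leaf≢parent     = vp≢a ∘ sym
  ; edge-range      = 1≤k , ≤-trans (n≤1+n k) a≤t
  ; leaf-range      = s≤s z≤n , a≤t
  ; t≤t′            = ≤-refl
  ; fresh           = λ i t<i i≤t → contradiction i≤t (<⇒≱ t<i)
  }
  where
  a≤t : suc k ≤ t
  a≤t = m+n≤o⇒m≤o (suc k) a+d≤t

edge-above-leaf-above : ∀ {a d vp t} → a + d ≤ t → vp ≤ a + d → LeafColours a d vp t
edge-above-leaf-above {a} {d} {vp} {t} a+d≤t vp≤a+d = record
  { edge = suc (a + d) ; leaf = suc (suc (a + d)) ; parent-lo = a ; leaf-lo = suc (a + d)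
  ; t′ = t ⊔ suc (suc (a + d))
  ; edge∉parent     = λ (_ , edge≤) → 1+n≰n edge≤
  ; parent-interval = interval-extendʳ a d
  ; leaf-interval   = λ c → ⇔.trans (mk⇔ swap swap) (consecutive⇔interval (suc (a + d)) c)
  ; leaf≢edge       = 1+n≢n
  ; leaf≢parent     = λ leaf≡vp →
      1+n≰n (≤-trans (n≤1+n (suc (a + d))) (subst (_≤ a + d) (sym leaf≡vp) vp≤a+d))
  ; edge-range      = s≤s z≤n , ≤-trans (n≤1+n _) (m≤n⊔m t _)
  ; leaf-range      = s≤s z≤n , m≤n⊔m t _
  ; t≤t′            = m≤m⊔n t _
  ; fresh           = fresh
  }
  where
  fresh : ∀ i → t < i → i ≤ t ⊔ suc (suc (a + d)) → i ≡ suc (a + d) ⊎ i ≡ suc (suc (a + d))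
  fresh i t<i i≤t′ with m≤n⇒m<n∨m≡n (m<n∧n≤m⊔o⇒n≤o _ t<i i≤t′)
  ... | inj₁ i<leaf = inj₁ (≤-antisym (≤-pred i<leaf) (≤-trans (s≤s a+d≤t) t<i))
  ... | inj₂ i≡leaf = inj₂ i≡leaf

edge-above-leaf-below : ∀ {a d vp t} → 1 ≤ a → a + d ≤ t → a + d ≢ vp → LeafColours a d vp t
edge-above-leaf-below {a} {d} {vp} {t} 1≤a a+d≤t a+d≢vp = record
  { edge = suc (a + d) ; leaf = a + d ; parent-lo = a ; leaf-lo = a + d ; t′ = t ⊔ suc (a + d)
  ; edge∉parent     = λ (_ , edge≤) → 1+n≰n edge≤
  ; parent-interval = interval-extendʳ a d
  ; leaf-interval   = consecutive⇔interval (a + d)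
  ; leaf≢edge       = 1+n≢n ∘ sym
  ; leaf≢parent     = a+d≢vp
  ; edge-range      = s≤s z≤n , m≤n⊔m t _
  ; leaf-range      = ≤-trans 1≤a (m≤m+n a d) , ≤-trans a+d≤t (m≤m⊔n t _)
  ; t≤t′            = m≤m⊔n t _
  ; fresh           = λ i t<i i≤t′ →
      inj₁ (≤-antisym (m<n∧n≤m⊔o⇒n≤o _ t<i i≤t′) (≤-trans (s≤s a+d≤t) t<i))
  }

-- When a = vp = 2 the leaf gets colour a + d just below the new edge; it differs
-- from vp because d = 0 would force a = 1.
leaf-colours : ∀ {a d vp t k} → 1 ≤ a → a + d ≤ t → t ≤ k + 2 → suc d ≤ k →
              a ≤ vp × vp ≤ a + d → (d ≡ 0 → a ≡ 1) →
              Σ (LeafColours a d vp t) (λ L → LeafColours.t′ L ≤ k + 2)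
leaf-colours {suc zero} {d} {k = k} _ a+d≤t t≤k+2 d<k (_ , vp≤a+d) _ =
  edge-above-leaf-above a+d≤t vp≤a+d , ⊔-lub t≤k+2 (subst (3 + d ≤_) (+-comm 2 k) (s≤s (s≤s d<k)))
leaf-colours {suc (suc zero)} {d} {vp} {k = k} _ a+d≤t t≤k+2 d<k _ isolated with vp ≟ℕ 2
... | no vp≢2 = edge-below-leaf-above (s≤s z≤n) a+d≤t vp≢2 , t≤k+2
... | yes vp≡2 =
  edge-above-leaf-below (s≤s z≤n) a+d≤t 2+d≢vp ,
  ⊔-lub t≤k+2 (subst (3 + d ≤_) (+-comm 2 k) (s≤s (s≤s d<k)))
  where
  2+d≢vp : 2 + d ≢ vp
  2+d≢vp 2+d≡vp = contradiction (isolated (suc-injective (suc-injective (trans 2+d≡vp vp≡2)))) λ ()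
leaf-colours {suc (suc (suc a))} _ a+d≤t t≤k+2 _ (a≤vp , _) _ = edge-below-leaf-below a+d≤t a≤vp , t≤k+2

-- Counting and degrees

¬T⇒≡false : ∀ {b} → ¬ T b → b ≡ false
¬T⇒≡false {false} _  = refl
¬T⇒≡false {true}  ¬T = ⊥-elim (¬T _)

indicator : Bool → ℕ
indicator b = if b then 1 else 0

count : ∀ {n} → (Fin n → Bool) → ℕ
count P = sum (indicator ∘ P)

count-cong : ∀ {n} {P Q : Fin n → Bool} → P ≗ Q → count P ≡ count Q
count-cong P≗Q = sum-cong-≗ (cong indicator ∘ P≗Q)

count-false : ∀ n → count {n} (const false) ≡ 0
count-false = sum-replicate-zero

count-mono : ∀ {n} {P Q : Fin n → Bool} → (∀ u → T (P u) → T (Q u)) → count P ≤ count Q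
count-mono {zero}  _   = z≤n
count-mono {suc n} P⇒Q = +-mono-≤ (indicator-mono (P⇒Q zero)) (count-mono (P⇒Q ∘ suc))
  where
  indicator-mono : ∀ {a b} → (T a → T b) → indicator a ≤ indicator b
  indicator-mono {false}         _   = z≤n
  indicator-mono {true} {true}   _   = ≤-refl
  indicator-mono {true} {false} a⇒b = ⊥-elim (a⇒b _)

count-insert : ∀ {n} {P Q : Fin n → Bool} w → (∀ u → u ≢ w → P u ≡ Q u) →
               P w ≡ false → Q w ≡ true → count Q ≡ suc (count P)
count-insert {suc n} {P} {Q} zero agree Pw Qw = begin
  indicator (Q zero) + count (Q ∘ suc)  ≡⟨ cong (λ b → indicator b + count (Q ∘ suc)) Qw ⟩
  suc (count (Q ∘ suc))                 ≡⟨ cong suc (count-cong (λ u → agree (suc u) λ ())) ⟨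
  suc (count (P ∘ suc))                 ≡⟨ cong (λ b → suc (indicator b + count (P ∘ suc))) Pw ⟨
  suc (count P)                         ∎
count-insert {suc n} {P} {Q} (suc w) agree Pw Qw = begin
  indicator (Q zero) + count (Q ∘ suc)        ≡⟨ cong₂ _+_ (cong indicator (sym (agree zero λ ()))) IH ⟩
  indicator (P zero) + suc (count (P ∘ suc))  ≡⟨ +-suc _ _ ⟩
  suc (count P)                               ∎
  where
  IH : count (Q ∘ suc) ≡ suc (count (P ∘ suc))
  IH = count-insert w (λ u u≢w → agree (suc u) (u≢w ∘ Finₚ.suc-injective)) Pw Qw

count≡0⇒false : ∀ {n} {P : Fin n → Bool} → count P ≡ 0 → ∀ u → P u ≡ false
count≡0⇒false {suc n} {P} count≡0 zero    = indicator≡0 (m+n≡0⇒m≡0 _ count≡0)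
  where
  indicator≡0 : ∀ {b} → indicator b ≡ 0 → b ≡ false
  indicator≡0 {false} _ = refl
count≡0⇒false {suc n}     count≡0 (suc u) = count≡0⇒false (m+n≡0⇒n≡0 _ count≡0) u

count≢0⇒∃ : ∀ {n} {P : Fin n → Bool} → count P ≢ 0 → ∃ λ u → P u ≡ true
count≢0⇒∃ {zero}      count≢0 = contradiction refl count≢0
count≢0⇒∃ {suc n} {P} count≢0 with P zero in P0
... | true  = zero , P0
... | false = Product.map suc id (count≢0⇒∃ count≢0)

sumᴸ-tabulate : ∀ {n} (f : Fin n → ℕ) → sumᴸ (tabulate f) ≡ sum f
sumᴸ-tabulate {zero}  f = refl
sumᴸ-tabulate {suc n} f = cong (f zero +_) (sumᴸ-tabulate (f ∘ suc))

∈⇒≤foldr-⊔ : ∀ {x xs} → x ∈ᴸ xs → x ≤ foldr _⊔_ 0 xs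
∈⇒≤foldr-⊔ {xs = y ∷ _} (here refl)  = m≤m⊔n y _
∈⇒≤foldr-⊔ {xs = y ∷ _} (there x∈xs) = ≤-trans (∈⇒≤foldr-⊔ x∈xs) (m≤n⊔m y _)

deg≡count : ∀ {n} (G : Graph n) v → deg G v ≡ count (adj G v)
deg≡count G v =
  trans (cong sumᴸ (map-tabulate id (indicator ∘ adj G v))) (sumᴸ-tabulate (indicator ∘ adj G v))

deg≤Δ : ∀ {n} (G : Graph n) v → deg G v ≤ Δ G
deg≤Δ G v = ∈⇒≤foldr-⊔ (∈-map⁺ (deg G) (∈-allFin v))

Subset : ℕ → Set
Subset n = Fin n → Bool

_∈_ _∉_ : ∀ {n} → Fin n → Subset n → Set
x ∈ S = S x ≡ true
x ∉ S = S x ≡ false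

∈∧∉⇒≢ : ∀ {n} {S : Subset n} {x y} → x ∈ S → y ∉ S → x ≢ y
∈∧∉⇒≢ x∈S y∉S refl with () ← trans (sym x∈S) y∉S

infixl 6 _[_]≔_ _[_][_]≔_

_[_]≔_ : ∀ {A : Set} {n} → (Fin n → A) → Fin n → A → Fin n → A
f [ i ]≔ x = updateAt f i (const x)

[]≔-updates : ∀ {A : Set} {n} (f : Fin n → A) i {x} → (f [ i ]≔ x) i ≡ x
[]≔-updates f i = updateAt-updates i f

[]≔-minimal : ∀ {A : Set} {n} (f : Fin n → A) {i j x} → j ≢ i → (f [ i ]≔ x) j ≡ f j
[]≔-minimal f {i} {j} = updateAt-minimal j i f

_[_][_]≔_ : ∀ {A : Set} {n} → (Fin n → Fin n → A) → Fin n → Fin n → A → Fin n → Fin n → A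
m [ i ][ j ]≔ x = m [ i ]≔ (m i [ j ]≔ x)

[][]≔-updates : ∀ {A : Set} {n} (m : Fin n → Fin n → A) i j {x} → (m [ i ][ j ]≔ x) i j ≡ x
[][]≔-updates m i j = trans (cong (λ row → row j) ([]≔-updates m i)) ([]≔-updates (m i) j)

[][]≔-minimalˡ : ∀ {A : Set} {n} (m : Fin n → Fin n → A) {i j k l x} → k ≢ i →
                 (m [ i ][ j ]≔ x) k l ≡ m k l
[][]≔-minimalˡ m {l = l} k≢i = cong (λ row → row l) ([]≔-minimal m k≢i)

[][]≔-minimalʳ : ∀ {A : Set} {n} (m : Fin n → Fin n → A) {i j k l x} → l ≢ j →
                 (m [ i ][ j ]≔ x) k l ≡ m k l
[][]≔-minimalʳ m {i} {j} {k} {l} l≢j with k ≟ i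
... | yes refl = trans (cong (λ row → row l) ([]≔-updates m k)) ([]≔-minimal (m k) l≢j)
... | no k≢i   = [][]≔-minimalˡ m k≢i

insert : ∀ {n} → Fin n → Subset n → Subset n
insert w S = S [ w ]≔ true

∈-insert : ∀ {n} {S : Subset n} w → w ∈ insert w S
∈-insert {S = S} w = []≔-updates S w

∈-insert⁺ : ∀ {n} {S : Subset n} {w x} → x ∈ S → x ∈ insert w S
∈-insert⁺ {w = w} {x} x∈S with x ≟ w
... | yes refl = ∈-insert w
... | no x≢w   = trans ([]≔-minimal _ x≢w) x∈S

∈-insert⁻ : ∀ {n} {S : Subset n} w {x} → x ∈ insert w S → x ≡ w ⊎ x ∈ S
∈-insert⁻ w {x} x∈ with x ≟ w
... | yes x≡w = inj₁ x≡w
... | no x≢w  = inj₂ (trans (sym ([]≔-minimal _ x≢w)) x∈)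

count-not-insert : ∀ {n} {S : Subset n} {w} → w ∉ S → count (not ∘ S) ≡ suc (count (not ∘ insert w S))
count-not-insert {S = S} {w} w∉S =
  count-insert w (λ u u≢w → cong not ([]≔-minimal S u≢w)) (cong not (∈-insert w)) (cong not w∉S)

-- Degrees into and paths inside a subset

module _ {n : ℕ} (G : Graph n) where

  Adj-sym : ∀ {u v} → Adj G u v → Adj G v u
  Adj-sym {u} {v} = subst T (Graph.sym G u v)

  Adj-irrefl : ∀ {v} → ¬ Adj G v v
  Adj-irrefl {v} = subst T (Graph.irrefl G v)

  degIn : Subset n → Fin n → ℕ
  degIn S v = count (λ u → adj G v u ∧ S u)

  degIn≤deg : ∀ S v → degIn S v ≤ deg G v
  degIn≤deg S v = subst (degIn S v ≤_) (sym (deg≡count G v))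
                        (count-mono {P = λ u → adj G v u ∧ S u} (λ _ → proj₁ ∘ to T-∧))

  degIn-full : ∀ {S} → (∀ u → u ∈ S) → ∀ v → degIn S v ≡ deg G v
  degIn-full all∈S v =
    trans (count-cong (λ u → trans (cong (adj G v u ∧_) (all∈S u)) (∧-identityʳ _)))
          (sym (deg≡count G v))

  degIn-insert : ∀ {S v w} → w ∉ S → Adj G v w → degIn (insert w S) v ≡ suc (degIn S v)
  degIn-insert {S} {v} {w} w∉S vw = count-insert w
    (λ u u≢w → cong (adj G v u ∧_) (sym ([]≔-minimal S u≢w)))
    (trans (cong (adj G v w ∧_) w∉S) (∧-zeroʳ _))
    (cong₂ _∧_ (to T-≡ vw) (∈-insert w))

  degIn-insert-nonadjacent : ∀ {S v w} → ¬ Adj G v w → degIn (insert w S) v ≡ degIn S v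
  degIn-insert-nonadjacent {S} {v} {w} ¬vw = count-cong same
    where
    same : ∀ u → (adj G v u ∧ insert w S u) ≡ (adj G v u ∧ S u)
    same u with u ≟ w
    ... | yes refl = trans (cong (_∧ insert w S w) (¬T⇒≡false ¬vw)) (sym (cong (_∧ S w) (¬T⇒≡false ¬vw)))
    ... | no u≢w   = cong (adj G v u ∧_) ([]≔-minimal S u≢w)

  degIn-unique-neighbour : ∀ {S v p} → p ∈ S → Adj G v p → (∀ {u} → u ∈ S → Adj G v u → u ≡ p) →
                           degIn S v ≡ 1
  degIn-unique-neighbour {S} {v} {p} p∈S vp unique = begin
    degIn S v                      ≡⟨ count-insert p (λ u u≢p → sym (not-neighbour u u≢p))
                                        refl (cong₂ _∧_ (to T-≡ vp) p∈S) ⟩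
    suc (count {n} (const false))  ≡⟨ cong suc (count-false n) ⟩
    1                              ∎
    where
    not-neighbour : ∀ u → u ≢ p → (adj G v u ∧ S u) ≡ false
    not-neighbour u u≢p = ¬T⇒≡false λ vu∧u∈S →
      let vu , u∈S = to T-∧ vu∧u∈S in u≢p (unique (to T-≡ u∈S) vu)

  data Route : Fin n → Fin n → List (Fin n) → Set where
    stop : ∀ {x} → Route x x [ x ]
    hop  : ∀ {x y z vs} → Adj G x z → Route z y vs → Route x y (x ∷ vs)

  route-snoc : ∀ {x y w vs} → Route x y vs → Adj G y w → Route x w (vs ++ [ w ])
  route-snoc stop         yw = hop yw stop
  route-snoc (hop xz xy) yw = hop xz (route-snoc xy yw)

  route-length : ∀ {x y vs} → Route x y vs → x ≢ y → 2 ≤ length vs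
  route-length stop              x≢y = contradiction refl x≢y
  route-length (hop _ stop)      _   = s≤s (s≤s z≤n)
  route-length (hop _ (hop _ _)) _   = s≤s (s≤s z≤n)

  route-closed : ∀ {u x y w vs} → Adj G u x → Route x y vs → Adj G y w →
                 Linked (Adj G) (u ∷ vs ++ [ w ])
  route-closed ux stop         yw = ux ∷ yw ∷ [-]
  route-closed ux (hop xz zy) yw = ux ∷ route-closed xz zy yw

  PathIn : Subset n → Fin n → Fin n → Set
  PathIn S x y = ∃ λ vs → Route x y vs × Unique vs × All (_∈ S) vs

  ConnectedIn : Subset n → Set
  ConnectedIn S = ∀ {x y} → x ∈ S → y ∈ S → PathIn S x y

  -- Two S-neighbours x ≢ y of w ∉ S would close the cycle w, x, …, y, w.
  acyclic⇒unique-neighbour : Acyclic G → ∀ {S w x y} → ConnectedIn S → w ∉ S →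
                             x ∈ S → y ∈ S → Adj G w x → Adj G w y → x ≡ y
  acyclic⇒unique-neighbour acyclic connected w∉S x∈S y∈S wx wy with _ ≟ _
  ... | yes x≡y = x≡y
  ... | no x≢y with connected x∈S y∈S
  ...   | vs , xy , unique , all∈S = ⊥-elim (acyclic (_ ∷ vs)
          ( s≤s (route-length xy x≢y)
          , All.map (λ v∈S → ∈∧∉⇒≢ v∈S w∉S ∘ sym) all∈S ∷ unique
          , route-closed wx xy (Adj-sym wy) ))

  connected-singleton : ∀ {x} → ConnectedIn (insert x (const false))
  connected-singleton {x} {y} {z} y∈ z∈
    with ∈-insert⁻ x y∈ | ∈-insert⁻ x z∈
  ... | inj₁ refl | inj₁ refl = [ x ] , stop , [] ∷ [] , ∈-insert x ∷ []

  connected-insert : ∀ {S p w} → ConnectedIn S → p ∈ S → w ∉ S → Adj G p w → ConnectedIn (insert w S)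
  connected-insert {S} {p} {w} connected p∈S w∉S pw {x} {y} x∈ y∈ with ∈-insert⁻ w x∈ | ∈-insert⁻ w y∈
  ... | inj₁ refl | inj₁ refl = [ w ] , stop , [] ∷ [] , ∈-insert w ∷ []
  ... | inj₁ refl | inj₂ y∈S =
    let vs , py , unique , all∈S = connected p∈S y∈S in
    w ∷ vs , hop (Adj-sym pw) py , All.map (λ v∈S → ∈∧∉⇒≢ {S = S} v∈S w∉S ∘ sym) all∈S ∷ unique
           , ∈-insert w ∷ All.map (∈-insert⁺ {S = S}) all∈S
  ... | inj₂ x∈S | inj₁ refl =
    let vs , xp , unique , all∈S = connected x∈S p∈S in
    vs ++ [ w ] , route-snoc xp pw , Unique.++⁺ unique ([] ∷ []) (w∉vs all∈S)
                , ∷ʳ⁺ (All.map (∈-insert⁺ {S = S}) all∈S) (∈-insert w)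
    where
    w∉vs : ∀ {vs} → All (_∈ S) vs → Disjoint vs [ w ]
    w∉vs all∈S (v∈vs , here refl) = ∈∧∉⇒≢ {S = S} (All.lookup all∈S v∈vs) w∉S refl
  ... | inj₂ x∈S | inj₂ y∈S =
    let vs , xy , unique , all∈S = connected x∈S y∈S in
    vs , xy , unique , All.map (∈-insert⁺ {S = S}) all∈S

  boundary-edge : ∀ {S r v} → r ∈ S → v ∉ S → Walk G r v → ∃₂ λ p w → p ∈ S × w ∉ S × Adj G p w
  boundary-edge {S} r∈S v∉S here = ⊥-elim (∈∧∉⇒≢ {S = S} r∈S v∉S refl)
  boundary-edge {S} {r} r∈S v∉S (step {w = z} rz zv) with S z in z∈?
  ... | true  = boundary-edge z∈? v∉S zv
  ... | false = r , z , r∈S , z∈? , rz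

module _ {n : ℕ} (G : Graph n) where

  AtVertexIn : Subset n → (Fin n → ℕ) → (Fin n → Fin n → ℕ) → Fin n → ℕ → Set
  AtVertexIn S vc ec v c = vc v ≡ c ⊎ ∃ λ u → Adj G v u × u ∈ S × ec v u ≡ c

  record PartialColoring (S : Subset n) (t : ℕ) : Set where
    field
      vc          : Fin n → ℕ
      ec          : Fin n → Fin n → ℕ
      lo          : Fin n → ℕ
      ec-sym      : ∀ {u v} → u ∈ S → v ∈ S → Adj G u v → ec u v ≡ ec v u
      vc-range    : ∀ {v} → v ∈ S → 1 ≤ vc v × vc v ≤ t
      ec-range    : ∀ {u v} → u ∈ S → v ∈ S → Adj G u v → 1 ≤ ec u v × ec u v ≤ t
      vv-proper   : ∀ {u v} → u ∈ S → v ∈ S → Adj G u v → vc u ≢ vc v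
      ee-proper   : ∀ {u v z} → u ∈ S → v ∈ S → z ∈ S → Adj G u v → Adj G u z → v ≢ z →
                    ec u v ≢ ec u z
      ve-proper   : ∀ {u v} → u ∈ S → v ∈ S → Adj G u v → vc u ≢ ec u v
      all-used    : ∀ i → 1 ≤ i → i ≤ t →
                    (∃ λ v → v ∈ S × vc v ≡ i) ⊎ (∃₂ λ u v → u ∈ S × v ∈ S × Adj G u v × ec u v ≡ i)
      interval    : ∀ {v} → v ∈ S → ∀ c →
                    AtVertexIn S vc ec v c ⇔ (lo v ≤ c × c ≤ lo v + degIn G S v)
      -- Only the root is ever isolated in S; starting its interval at 1 rules out the one
      -- configuration, lo = vc = 2 with no coloured edges, in which no leaf fits.
      lo-isolated : ∀ {v} → v ∈ S → degIn G S v ≡ 0 → lo v ≡ 1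

    at-range : ∀ {v c} → v ∈ S → AtVertexIn S vc ec v c → 1 ≤ c × c ≤ t
    at-range v∈S (inj₁ refl)                 = vc-range v∈S
    at-range v∈S (inj₂ (u , vu , u∈S , refl)) = ec-range v∈S u∈S vu

    1≤lo : ∀ {v} → v ∈ S → 1 ≤ lo v
    1≤lo v∈S = proj₁ (at-range v∈S (from (interval v∈S _) (≤-refl , m≤m+n _ _)))

    lo+degIn≤t : ∀ {v} → v ∈ S → lo v + degIn G S v ≤ t
    lo+degIn≤t v∈S = proj₂ (at-range v∈S (from (interval v∈S _) (m≤m+n _ _ , ≤-refl)))

    vc∈interval : ∀ {v} → v ∈ S → lo v ≤ vc v × vc v ≤ lo v + degIn G S v
    vc∈interval v∈S = to (interval v∈S _) (inj₁ refl)

-- Adding a leaf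

module Extension {n : ℕ} {G : Graph n} {S : Subset n} {t : ℕ} (C : PartialColoring G S t)
  {p w : Fin n} (p∈S : p ∈ S) (w∉S : w ∉ S) (pw : Adj G p w)
  (p-unique : ∀ {u} → u ∈ S → Adj G w u → u ≡ p)
  (L : LeafColours (PartialColoring.lo C p) (degIn G S p) (PartialColoring.vc C p) t) where

  open PartialColoring C
  open LeafColours L

  S′ : Subset n
  S′ = insert w S

  ≢w : ∀ {v} → v ∈ S → v ≢ w
  ≢w v∈S = ∈∧∉⇒≢ {S = S} v∈S w∉S

  p∈S′ : p ∈ S′
  p∈S′ = ∈-insert⁺ {S = S} p∈S

  w∈S′ : w ∈ S′
  w∈S′ = ∈-insert w

  data Vertex′ : Fin n → Set where
    old : ∀ {v} → v ∈ S → Vertex′ v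
    new : Vertex′ w

  vertex′ : ∀ {v} → v ∈ S′ → Vertex′ v
  vertex′ v∈S′ with ∈-insert⁻ w v∈S′
  ... | inj₁ refl = new
  ... | inj₂ v∈S  = old v∈S

  leaf-neighbour : ∀ {u} → u ∈ S′ → Adj G w u → u ≡ p
  leaf-neighbour u∈S′ wu with vertex′ u∈S′
  ... | new     = contradiction wu (Adj-irrefl G)
  ... | old u∈S = p-unique u∈S wu

  data Edge′ : Fin n → Fin n → Set where
    old  : ∀ {u v} → u ∈ S → v ∈ S → Edge′ u v
    up   : Edge′ w p
    down : Edge′ p w

  edge′ : ∀ {u v} → u ∈ S′ → v ∈ S′ → Adj G u v → Edge′ u v
  edge′ u∈S′ v∈S′ uv with vertex′ u∈S′ | vertex′ v∈S′
  ... | new | _ with leaf-neighbour v∈S′ uv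
  ...   | refl = up
  edge′ u∈S′ v∈S′ uv | old u∈S | new with leaf-neighbour u∈S′ (Adj-sym G uv)
  ...   | refl = down
  edge′ u∈S′ v∈S′ uv | old u∈S | old v∈S = old u∈S v∈S

  vc′ : Fin n → ℕ
  vc′ = vc [ w ]≔ leaf

  ec′ : Fin n → Fin n → ℕ
  ec′ = ec [ p ][ w ]≔ edge [ w ][ p ]≔ edge

  lo′ : Fin n → ℕ
  lo′ = lo [ p ]≔ parent-lo [ w ]≔ leaf-lo

  vc′-new : vc′ w ≡ leaf
  vc′-new = []≔-updates vc w

  vc′-old : ∀ {v} → v ∈ S → vc′ v ≡ vc v
  vc′-old v∈S = []≔-minimal vc (≢w v∈S)

  ec′-up : ec′ w p ≡ edge
  ec′-up = [][]≔-updates _ w p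

  ec′-down : ec′ p w ≡ edge
  ec′-down = trans ([][]≔-minimalˡ _ (≢w p∈S)) ([][]≔-updates ec p w)

  ec′-old : ∀ {u v} → u ∈ S → v ∈ S → ec′ u v ≡ ec u v
  ec′-old u∈S v∈S = trans ([][]≔-minimalˡ _ (≢w u∈S)) ([][]≔-minimalʳ ec (≢w v∈S))

  lo′-new : lo′ w ≡ leaf-lo
  lo′-new = []≔-updates _ w

  lo′-parent : lo′ p ≡ parent-lo
  lo′-parent = trans ([]≔-minimal _ (≢w p∈S)) ([]≔-updates lo p)

  lo′-old : ∀ {v} → v ∈ S → v ≢ p → lo′ v ≡ lo v
  lo′-old v∈S v≢p = trans ([]≔-minimal _ (≢w v∈S)) ([]≔-minimal lo v≢p)

  degIn′-new : degIn G S′ w ≡ 1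
  degIn′-new = degIn-unique-neighbour G p∈S′ (Adj-sym G pw) leaf-neighbour

  degIn′-parent : degIn G S′ p ≡ suc (degIn G S p)
  degIn′-parent = degIn-insert G w∉S pw

  degIn′-old : ∀ {v} → v ∈ S → v ≢ p → degIn G S′ v ≡ degIn G S v
  degIn′-old v∈S v≢p = degIn-insert-nonadjacent G (v≢p ∘ p-unique v∈S ∘ Adj-sym G)

  edge∉at-parent : ¬ AtVertexIn G S vc ec p edge
  edge∉at-parent at = edge∉parent (to (interval p∈S edge) at)

  at-lift : ∀ {v c} → v ∈ S → AtVertexIn G S vc ec v c → AtVertexIn G S′ vc′ ec′ v c
  at-lift v∈S (inj₁ vc≡c)                  = inj₁ (trans (vc′-old v∈S) vc≡c)
  at-lift v∈S (inj₂ (u , vu , u∈S , ec≡c)) =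
    inj₂ (u , vu , ∈-insert⁺ {S = S} u∈S , trans (ec′-old v∈S u∈S) ec≡c)

  at-new : ∀ c → AtVertexIn G S′ vc′ ec′ w c ⇔ (leaf ≡ c ⊎ edge ≡ c)
  at-new c = mk⇔ into onto
    where
    into : AtVertexIn G S′ vc′ ec′ w c → leaf ≡ c ⊎ edge ≡ c
    into (inj₁ vc′≡c) = inj₁ (trans (sym vc′-new) vc′≡c)
    into (inj₂ (u , wu , u∈S′ , ec′≡c)) with leaf-neighbour u∈S′ wu
    ... | refl = inj₂ (trans (sym ec′-up) ec′≡c)
    onto : leaf ≡ c ⊎ edge ≡ c → AtVertexIn G S′ vc′ ec′ w c
    onto (inj₁ leaf≡c) = inj₁ (trans vc′-new leaf≡c)
    onto (inj₂ edge≡c) = inj₂ (p , Adj-sym G pw , p∈S′ , trans ec′-up edge≡c)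

  at-parent : ∀ c → AtVertexIn G S′ vc′ ec′ p c ⇔ (AtVertexIn G S vc ec p c ⊎ edge ≡ c)
  at-parent c = mk⇔ into onto
    where
    into : AtVertexIn G S′ vc′ ec′ p c → AtVertexIn G S vc ec p c ⊎ edge ≡ c
    into (inj₁ vc′≡c) = inj₁ (inj₁ (trans (sym (vc′-old p∈S)) vc′≡c))
    into (inj₂ (u , pu , u∈S′ , ec′≡c)) with vertex′ u∈S′
    ... | new     = inj₂ (trans (sym ec′-down) ec′≡c)
    ... | old u∈S = inj₁ (inj₂ (u , pu , u∈S , trans (sym (ec′-old p∈S u∈S)) ec′≡c))
    onto : AtVertexIn G S vc ec p c ⊎ edge ≡ c → AtVertexIn G S′ vc′ ec′ p c
    onto (inj₁ at)     = at-lift p∈S at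
    onto (inj₂ edge≡c) = inj₂ (w , pw , w∈S′ , trans ec′-down edge≡c)

  at-old : ∀ {v} → v ∈ S → v ≢ p → ∀ c → AtVertexIn G S′ vc′ ec′ v c ⇔ AtVertexIn G S vc ec v c
  at-old {v} v∈S v≢p c = mk⇔ into (at-lift v∈S)
    where
    into : AtVertexIn G S′ vc′ ec′ v c → AtVertexIn G S vc ec v c
    into (inj₁ vc′≡c) = inj₁ (trans (sym (vc′-old v∈S)) vc′≡c)
    into (inj₂ (u , vu , u∈S′ , ec′≡c)) with vertex′ u∈S′
    ... | new     = contradiction (p-unique v∈S (Adj-sym G vu)) v≢p
    ... | old u∈S = inj₂ (u , vu , u∈S , trans (sym (ec′-old v∈S u∈S)) ec′≡c)

  ec-sym′ : ∀ {u v} → u ∈ S′ → v ∈ S′ → Adj G u v → ec′ u v ≡ ec′ v u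
  ec-sym′ u∈S′ v∈S′ uv with edge′ u∈S′ v∈S′ uv
  ... | old u∈S v∈S = trans (ec′-old u∈S v∈S) (trans (ec-sym u∈S v∈S uv) (sym (ec′-old v∈S u∈S)))
  ... | up          = trans ec′-up (sym ec′-down)
  ... | down        = trans ec′-down (sym ec′-up)

  vc-range′ : ∀ {v} → v ∈ S′ → 1 ≤ vc′ v × vc′ v ≤ t′
  vc-range′ v∈S′ with vertex′ v∈S′
  ... | new     = subst (λ c → 1 ≤ c × c ≤ t′) (sym vc′-new) leaf-range
  ... | old v∈S = subst (λ c → 1 ≤ c × c ≤ t′) (sym (vc′-old v∈S))
                        (Product.map₂ (λ ≤t → ≤-trans ≤t t≤t′) (vc-range v∈S))

  ec-range′ : ∀ {u v} → u ∈ S′ → v ∈ S′ → Adj G u v → 1 ≤ ec′ u v × ec′ u v ≤ t′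
  ec-range′ u∈S′ v∈S′ uv with edge′ u∈S′ v∈S′ uv
  ... | old u∈S v∈S = subst (λ c → 1 ≤ c × c ≤ t′) (sym (ec′-old u∈S v∈S))
                            (Product.map₂ (λ ≤t → ≤-trans ≤t t≤t′) (ec-range u∈S v∈S uv))
  ... | up          = subst (λ c → 1 ≤ c × c ≤ t′) (sym ec′-up) edge-range
  ... | down        = subst (λ c → 1 ≤ c × c ≤ t′) (sym ec′-down) edge-range

  vv-proper′ : ∀ {u v} → u ∈ S′ → v ∈ S′ → Adj G u v → vc′ u ≢ vc′ v
  vv-proper′ u∈S′ v∈S′ uv with edge′ u∈S′ v∈S′ uv
  ... | old u∈S v∈S = λ eq → vv-proper u∈S v∈S uv (trans (sym (vc′-old u∈S)) (trans eq (vc′-old v∈S)))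
  ... | up          = λ eq → leaf≢parent (trans (sym vc′-new) (trans eq (vc′-old p∈S)))
  ... | down        = λ eq → leaf≢parent (trans (sym vc′-new) (trans (sym eq) (vc′-old p∈S)))

  ve-proper′ : ∀ {u v} → u ∈ S′ → v ∈ S′ → Adj G u v → vc′ u ≢ ec′ u v
  ve-proper′ u∈S′ v∈S′ uv with edge′ u∈S′ v∈S′ uv
  ... | old u∈S v∈S = λ eq →
    ve-proper u∈S v∈S uv (trans (sym (vc′-old u∈S)) (trans eq (ec′-old u∈S v∈S)))
  ... | up          = λ eq → leaf≢edge (trans (sym vc′-new) (trans eq ec′-up))
  ... | down        = λ eq → edge∉at-parent (inj₁ (trans (sym (vc′-old p∈S)) (trans eq ec′-down)))

  ee-proper′ : ∀ {u v z} → u ∈ S′ → v ∈ S′ → z ∈ S′ → Adj G u v → Adj G u z → v ≢ z →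
               ec′ u v ≢ ec′ u z
  ee-proper′ u∈S′ v∈S′ z∈S′ uv uz v≢z with vertex′ u∈S′
  ... | new = contradiction (trans (leaf-neighbour v∈S′ uv) (sym (leaf-neighbour z∈S′ uz))) v≢z
  ... | old u∈S with vertex′ v∈S′ | vertex′ z∈S′
  ...   | new     | new     = contradiction refl v≢z
  ...   | new     | old z∈S with p-unique u∈S (Adj-sym G uv)
  ...     | refl = λ eq →
    edge∉at-parent (inj₂ (_ , uz , z∈S , trans (sym (ec′-old p∈S z∈S)) (trans (sym eq) ec′-down)))
  ee-proper′ u∈S′ v∈S′ z∈S′ uv uz v≢z | old u∈S | old v∈S | new with p-unique u∈S (Adj-sym G uz)
  ...     | refl = λ eq →
    edge∉at-parent (inj₂ (_ , uv , v∈S , trans (sym (ec′-old p∈S v∈S)) (trans eq ec′-down)))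
  ee-proper′ u∈S′ v∈S′ z∈S′ uv uz v≢z | old u∈S | old v∈S | old z∈S =
    λ eq → ee-proper u∈S v∈S z∈S uv uz v≢z (trans (sym (ec′-old u∈S v∈S)) (trans eq (ec′-old u∈S z∈S)))

  all-used′ : ∀ i → 1 ≤ i → i ≤ t′ →
              (∃ λ v → v ∈ S′ × vc′ v ≡ i) ⊎ (∃₂ λ u v → u ∈ S′ × v ∈ S′ × Adj G u v × ec′ u v ≡ i)
  all-used′ i 1≤i i≤t′ with i ≤? t
  ... | yes i≤t = Sum.map
    (λ (v , v∈S , vc≡i) → v , ∈-insert⁺ {S = S} v∈S , trans (vc′-old v∈S) vc≡i)
    (λ (u , v , u∈S , v∈S , uv , ec≡i) →
       u , v , ∈-insert⁺ {S = S} u∈S , ∈-insert⁺ {S = S} v∈S , uv , trans (ec′-old u∈S v∈S) ec≡i)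
    (all-used i 1≤i i≤t)
  ... | no i≰t with fresh i (≰⇒> i≰t) i≤t′
  ...   | inj₁ refl = inj₂ (p , w , p∈S′ , w∈S′ , pw , ec′-down)
  ...   | inj₂ refl = inj₁ (w , w∈S′ , vc′-new)

  interval′ : ∀ {v} → v ∈ S′ → ∀ c → AtVertexIn G S′ vc′ ec′ v c ⇔ (lo′ v ≤ c × c ≤ lo′ v + degIn G S′ v)
  interval′ {v} v∈S′ c with vertex′ v∈S′
  ... | new rewrite lo′-new | degIn′-new = ⇔.trans (at-new c) (leaf-interval c)
  ... | old v∈S with v ≟ p
  ...   | yes refl rewrite lo′-parent | degIn′-parent =
    ⇔.trans (at-parent c) (⇔.trans (interval p∈S c ⊎-⇔ ⇔.refl) (parent-interval c))
  ...   | no v≢p rewrite lo′-old v∈S v≢p | degIn′-old v∈S v≢p =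
    ⇔.trans (at-old v∈S v≢p c) (interval v∈S c)

  lo-isolated′ : ∀ {v} → v ∈ S′ → degIn G S′ v ≡ 0 → lo′ v ≡ 1
  lo-isolated′ {v} v∈S′ isolated with vertex′ v∈S′
  ... | new = contradiction (trans (sym degIn′-new) isolated) λ ()
  ... | old v∈S with v ≟ p
  ...   | yes refl = contradiction (trans (sym degIn′-parent) isolated) λ ()
  ...   | no v≢p   =
    trans (lo′-old v∈S v≢p) (lo-isolated v∈S (trans (sym (degIn′-old v∈S v≢p)) isolated))

  extended : PartialColoring G S′ t′
  extended = record
    { vc = vc′ ; ec = ec′ ; lo = lo′
    ; ec-sym = ec-sym′ ; vc-range = vc-range′ ; ec-range = ec-range′
    ; vv-proper = vv-proper′ ; ee-proper = ee-proper′ ; ve-proper = ve-proper′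
    ; all-used = all-used′ ; interval = interval′ ; lo-isolated = lo-isolated′
    }

-- Growing the colouring over the whole tree

module _ {n : ℕ} (G : Graph n) where

  record ColoredSubtree : Set where
    field
      S         : Subset n
      root      : Fin n
      root∈S    : root ∈ S
      connected : ConnectedIn G S
      t         : ℕ
      t≤Δ+2     : t ≤ Δ G + 2
      coloring  : PartialColoring G S t

    open PartialColoring coloring

    1≤t : 1 ≤ t
    1≤t = ≤-trans (proj₁ (vc-range root∈S)) (proj₂ (vc-range root∈S))

  singleton-coloring : ∀ r → PartialColoring G (insert r (const false)) 1
  singleton-coloring r = record
    { vc = const 1 ; ec = λ _ _ → 1 ; lo = const 1
    ; ec-sym      = λ u∈ v∈ uv → ⊥-elim (no-edge u∈ v∈ uv)
    ; vc-range    = λ _ → ≤-refl , ≤-refl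
    ; ec-range    = λ _ _ _ → ≤-refl , ≤-refl
    ; vv-proper   = λ u∈ v∈ uv → ⊥-elim (no-edge u∈ v∈ uv)
    ; ee-proper   = λ u∈ v∈ _ uv _ _ → ⊥-elim (no-edge u∈ v∈ uv)
    ; ve-proper   = λ u∈ v∈ uv → ⊥-elim (no-edge u∈ v∈ uv)
    ; all-used    = λ i 1≤i i≤1 → inj₁ (r , ∈-insert r , ≤-antisym 1≤i i≤1)
    ; interval    = interval
    ; lo-isolated = λ _ _ → refl
    }
    where
    S₀ : Subset n
    S₀ = insert r (const false)

    ∈S₀⇒≡r : ∀ {v} → v ∈ S₀ → v ≡ r
    ∈S₀⇒≡r v∈ with ∈-insert⁻ r v∈
    ... | inj₁ v≡r = v≡r

    no-edge : ∀ {u v} → u ∈ S₀ → v ∈ S₀ → ¬ Adj G u v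
    no-edge u∈ v∈ with ∈S₀⇒≡r u∈ | ∈S₀⇒≡r v∈
    ... | refl | refl = Adj-irrefl G

    degIn₀ : degIn G S₀ r ≡ 0
    degIn₀ = begin
      degIn G S₀ r                ≡⟨ degIn-insert-nonadjacent G (Adj-irrefl G) ⟩
      degIn G (const false) r     ≡⟨ count-cong (λ u → ∧-zeroʳ (adj G r u)) ⟩
      count {n} (const false)     ≡⟨ count-false n ⟩
      0                           ∎

    interval : ∀ {v} → v ∈ S₀ → ∀ c →
               AtVertexIn G S₀ (const 1) (λ _ _ → 1) v c ⇔ (1 ≤ c × c ≤ 1 + degIn G S₀ v)
    interval v∈ c with ∈S₀⇒≡r v∈
    ... | refl rewrite degIn₀ = mk⇔ into onto
      where
      into : AtVertexIn G S₀ (const 1) (λ _ _ → 1) r c → 1 ≤ c × c ≤ 1 + 0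
      into (inj₁ refl)                 = ≤-refl , ≤-refl
      into (inj₂ (u , ru , u∈S₀ , _)) = ⊥-elim (no-edge v∈ u∈S₀ ru)
      onto : 1 ≤ c × c ≤ 1 + 0 → AtVertexIn G S₀ (const 1) (λ _ _ → 1) r c
      onto (1≤c , c≤1) = inj₁ (≤-antisym 1≤c c≤1)

  singleton : Fin n → ColoredSubtree
  singleton r = record
    { S = insert r (const false) ; root = r ; root∈S = ∈-insert r ; connected = connected-singleton G
    ; t = 1 ; t≤Δ+2 = ≤-trans (s≤s z≤n) (m≤n+m 2 (Δ G)) ; coloring = singleton-coloring r }

  addLeaf : Acyclic G → (K : ColoredSubtree) → let open ColoredSubtree K in
            ∀ {p w} → p ∈ S → w ∉ S → Adj G p w → ColoredSubtree
  addLeaf acyclic K {p} {w} p∈S w∉S pw = record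
    { S = insert w S ; root = root ; root∈S = ∈-insert⁺ {S = S} root∈S
    ; connected = connected-insert G connected p∈S w∉S pw
    ; t = LeafColours.t′ (proj₁ chosen) ; t≤Δ+2 = proj₂ chosen
    ; coloring = Extension.extended coloring p∈S w∉S pw p-unique (proj₁ chosen) }
    where
    open ColoredSubtree K
    open PartialColoring coloring

    p-unique : ∀ {u} → u ∈ S → Adj G w u → u ≡ p
    p-unique u∈S wu = acyclic⇒unique-neighbour G acyclic connected w∉S u∈S p∈S wu (Adj-sym G pw)

    degIn<Δ : suc (degIn G S p) ≤ Δ G
    degIn<Δ = ≤-trans (≤-reflexive (sym (degIn-insert G w∉S pw)))
                      (≤-trans (degIn≤deg G (insert w S) p) (deg≤Δ G p))

    chosen : Σ (LeafColours (lo p) (degIn G S p) (vc p) t) λ L → LeafColours.t′ L ≤ Δ G + 2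
    chosen =
      leaf-colours (1≤lo p∈S) (lo+degIn≤t p∈S) t≤Δ+2 degIn<Δ (vc∈interval p∈S) (lo-isolated p∈S)

  outside : ColoredSubtree → ℕ
  outside K = count (not ∘ ColoredSubtree.S K)

  grow : Acyclic G → Connected G → ∀ k (K : ColoredSubtree) → outside K ≡ k →
         ∃ λ K → ∀ v → v ∈ ColoredSubtree.S K
  grow _ _ zero K outside≡0 = K , λ v → not-injective (count≡0⇒false outside≡0 v)
  grow acyclic connected (suc k) K outside≡1+k
    with count≢0⇒∃ (λ outside≡0 → 1+n≢0 (trans (sym outside≡1+k) outside≡0))
  ... | v , v∉S
    with boundary-edge G (ColoredSubtree.root∈S K) (not-injective v∉S)
                         (connected (ColoredSubtree.root K) v)
  ... | p , w , p∈S , w∉S , pw = grow acyclic connected k (addLeaf acyclic K p∈S w∉S pw)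
          (suc-injective (trans (sym (count-not-insert {S = ColoredSubtree.S K} w∉S)) outside≡1+k))

  spanning⇒coloring : (K : ColoredSubtree) → (∀ v → v ∈ ColoredSubtree.S K) →
                      IntervalTotalColoring G (ColoredSubtree.t K)
  spanning⇒coloring K all∈S = record
    { vc = vc ; ec = ec
    ; ec-sym    = λ u v → ec-sym (all∈S u) (all∈S v)
    ; vc-range  = λ v → vc-range (all∈S v)
    ; ec-range  = λ u v → ec-range (all∈S u) (all∈S v)
    ; vv-proper = λ u v → vv-proper (all∈S u) (all∈S v)
    ; ee-proper = λ u v z → ee-proper (all∈S u) (all∈S v) (all∈S z)
    ; ve-proper = λ u v → ve-proper (all∈S u) (all∈S v)
    ; all-used  = λ i 1≤i i≤t → Sum.map (Product.map₂ proj₂)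
                   (λ (u , v , _ , _ , uv , ec≡i) → u , v , uv , ec≡i) (all-used i 1≤i i≤t)
    ; interval  = λ v → lo v , λ c →
        subst (λ d → AtVertex G vc ec v c ⇔ (lo v ≤ c × c ≤ lo v + d)) (degIn-full G all∈S v)
              (⇔.trans at⇔atIn (interval (all∈S v) c))
    }
    where
    open ColoredSubtree K
    open PartialColoring coloring

    at⇔atIn : ∀ {v c} → AtVertex G vc ec v c ⇔ AtVertexIn G S vc ec v c
    at⇔atIn = mk⇔ (Sum.map₂ λ (u , vu , ec≡c) → u , vu , all∈S u , ec≡c)
                  (Sum.map₂ λ (u , vu , _ , ec≡c) → u , vu , ec≡c)

corollary5 : ∀ (n : ℕ) (T : Graph n) → IsTree T →
    Σ ℕ (λ t → 1 ≤ t × t ≤ Δ T + 2 × IntervalTotalColoring T t)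
corollary5 zero    T (() , _)
corollary5 (suc n) T (_ , connected , acyclic)
  with grow T acyclic connected _ (singleton T zero) refl
... | K , spanning = t , 1≤t , t≤Δ+2 , spanning⇒coloring T K spanning
  where open ColoredSubtree K
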